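{- Let $p(\alpha,\beta,\gamma)=(\alpha+1)(4\beta+3)(4\gamma+3)-(\alpha+1)-(4\beta+3)$ and let $\mathcal{N}_1=\{p(\alpha,\beta,\gamma):(\alpha,\beta,\gamma)\in\mathbb{Z}_{\ge0}^3\}$. Then $\mathcal{N}_1$ contains no perfect square. -}

module Defs where

open import Data.Integer using (ℤ; +_; _+_; _*_; _-_)

p : ℤ → ℤ → ℤ → ℤ
p α β γ = (α + + 1) * (+ 4 * β + + 3) * (+ 4 * γ + + 3) - (α + + 1) - (+ 4 * β + + 3)

-- Put A = α + 1, B = 4β + 3, C = 4γ + 3 and suppose K² = ABC − A − B, i.e.
-- K² + B = A·T with T = BC − 1 = 2^t·m, m odd, t ≥ 2.  Modulo m, −B is a square,
-- so (−B | m) = 1; modulo B, T ≡ −1, so (2 | B)^t (m | B) = (−1 | B) = −1.  Since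
-- B ≡ 3 (mod 4), Jacobi reciprocity turns the first fact into (m | B) = 1, hence t is
-- odd and (2 | B) = −1.  But then 8 ∣ T, so K² ≡ −B (mod 8), which forces B ≡ 7
-- (mod 8), and for such B we have (2 | B) = 1.
--
-- The Jacobi symbol (a | n) of an odd n = 2h + 1 is used in Schering's form of Gauss's
-- lemma: the parity of the number of x ∈ {1, …, h} with a·x mod n > h.  Reciprocity is
-- proved by Eisenstein's lattice-point count, so no factorisation into primes is needed.

module Submission where

open import Algebra.Bundles using (CommutativeMonoid)
open import Data.Empty using (⊥-elim)
open import Data.List.Base using (List; []; _∷_; _++_; map; length; applyDownFrom)
open import Data.List.Membership.Propositional using (_∈_)
open import Data.List.Membership.Propositional.Properties
  using (∈-∃++; ∈-++⁻; ∈-++⁺ˡ; ∈-++⁺ʳ; ∈-map⁻; ∈-applyDownFrom⁺; ∈-applyDownFrom⁻)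
open import Data.List.Properties using (length-++; length-map)
open import Data.List.Relation.Binary.Permutation.Propositional as ↭ using (_↭_; ↭-sym)
open import Data.List.Relation.Binary.Permutation.Propositional.Properties using (shift)
open import Data.List.Relation.Binary.Subset.Propositional using (_⊆_)
open import Data.List.Relation.Unary.All as All using (All; []; _∷_)
import Data.List.Relation.Unary.All.Properties as All
open import Data.List.Relation.Unary.AllPairs using ([]; _∷_)
open import Data.List.Relation.Unary.Any using (here; there)
open import Data.List.Relation.Unary.Unique.Propositional using (Unique)
import Data.List.Relation.Unary.Unique.Propositional.Properties as Unique
open import Data.Parity.Base as ℙ using (Parity; 0ℙ; 1ℙ)
import Data.Parity.Properties as ℙₚ
open import Data.Product.Base using (∃; ∃₂; _×_; _,_; proj₁; proj₂)
open import Data.Sum.Base using (_⊎_; inj₁; inj₂)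
open import Function.Base using (_∘_)
open import Level using (Level)
open import Relation.Binary.PropositionalEquality
  using (_≡_; _≢_; refl; sym; trans; cong; cong₂; subst; module ≡-Reasoning)
open import Relation.Nullary using (¬_; Dec; yes; no)

-- Natural-number arithmetic is opened only inside this block, so that _*_ in
-- lemma4p2 at the end is multiplication of integers.
module _ where

  open import Data.Nat.Base
  open import Data.Nat.Properties
  open import Data.Nat.Induction using (<-rec)
  open import Data.Nat.Tactic.RingSolver using (solve-∀)
  open import Data.Nat.DivMod
    using (_%_; _/_; %-distribˡ-+; %-distribˡ-*; [m+kn]%n≡m%n; [m+n]%n≡m%n; m<n⇒m%n≡m; m%n<n; m%n≤n;
           n%n≡0; m*n%n≡0; m%n%n≡m%n; m≡m%n+[m/n]*n; +-distrib-/-∣ʳ; m<n⇒m/n≡0; m*n/n≡m; /-monoˡ-≤;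
           m/n*n≤m; m<n*o⇒m/o<n)
  open import Data.Nat.Divisibility using (divides-refl)

  private
    variable
      ℓ : Level
      X : Set ℓ

  -- Sums over lists

  module ListSum {c ℓ′} (M : CommutativeMonoid c ℓ′) where

    open CommutativeMonoid M renaming (refl to ≈-refl; sym to ≈-sym; trans to ≈-trans)
    open import Algebra.Properties.CommutativeSemigroup commutativeSemigroup
      using (interchange; x∙yz≈y∙xz)
    open import Relation.Binary.Reasoning.Setoid setoid

    ∑ : (X → Carrier) → List X → Carrier
    ∑ f []       = ε
    ∑ f (x ∷ xs) = f x ∙ ∑ f xs

    ∑-cong : ∀ {f g : X → Carrier} xs → (∀ {x} → x ∈ xs → f x ≈ g x) → ∑ f xs ≈ ∑ g xs
    ∑-cong []       f≈g = ≈-refl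
    ∑-cong (x ∷ xs) f≈g = ∙-cong (f≈g (here refl)) (∑-cong xs (f≈g ∘ there))

    ∑-distrib : ∀ (f g : X → Carrier) xs → ∑ (λ x → f x ∙ g x) xs ≈ ∑ f xs ∙ ∑ g xs
    ∑-distrib f g []       = ≈-sym (identityˡ ε)
    ∑-distrib f g (x ∷ xs) = begin
      (f x ∙ g x) ∙ ∑ (λ x → f x ∙ g x) xs ≈⟨ ∙-congˡ (∑-distrib f g xs) ⟩
      (f x ∙ g x) ∙ (∑ f xs ∙ ∑ g xs)      ≈⟨ interchange (f x) (g x) (∑ f xs) (∑ g xs) ⟩
      (f x ∙ ∑ f xs) ∙ (g x ∙ ∑ g xs)      ∎

    ∑-map : ∀ {b} {B : Set b} (f : B → Carrier) (g : X → B) xs → ∑ f (map g xs) ≡ ∑ (f ∘ g) xs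
    ∑-map f g []       = refl
    ∑-map f g (x ∷ xs) = cong (f (g x) ∙_) (∑-map f g xs)

    ∑-↭ : ∀ (f : X → Carrier) {xs ys} → xs ↭ ys → ∑ f xs ≈ ∑ f ys
    ∑-↭ f ↭.refl         = ≈-refl
    ∑-↭ f (↭.prep x p)   = ∙-congˡ (∑-↭ f p)
    ∑-↭ f (↭.swap x y p) = ≈-trans (x∙yz≈y∙xz (f x) (f y) _) (∙-congˡ (∙-congˡ (∑-↭ f p)))
    ∑-↭ f (↭.trans p q)  = ≈-trans (∑-↭ f p) (∑-↭ f q)

    ∑-comm : ∀ {b} {B : Set b} (f : X → B → Carrier) xs ys →
             ∑ (λ x → ∑ (f x) ys) xs ≈ ∑ (λ y → ∑ (λ x → f x y) xs) ys
    ∑-comm f [] ys = ≈-sym (∑-ε ys)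
      where
      ∑-ε : ∀ ys → ∑ (λ _ → ε) ys ≈ ε
      ∑-ε []       = ≈-refl
      ∑-ε (y ∷ ys) = ≈-trans (identityˡ _) (∑-ε ys)
    ∑-comm f (x ∷ xs) ys = begin
      ∑ (f x) ys ∙ ∑ (λ x → ∑ (f x) ys) xs               ≈⟨ ∙-congˡ (∑-comm f xs ys) ⟩
      ∑ (f x) ys ∙ ∑ (λ y → ∑ (λ x → f x y) xs) ys       ≈⟨ ≈-sym (∑-distrib (f x) _ ys) ⟩
      ∑ (λ y → f x y ∙ ∑ (λ x → f x y) xs) ys            ∎

  module ℕ-Sum = ListSum +-0-commutativeMonoid
  module ℙ-Sum = ListSum ℙₚ.+-0-commutativeMonoid

  parity-∑ : ∀ (f : X → ℕ) xs → parity (ℕ-Sum.∑ f xs) ≡ ℙ-Sum.∑ (parity ∘ f) xs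
  parity-∑ f []       = refl
  parity-∑ f (x ∷ xs) = trans (ℙₚ.+-homo-+ (f x) _) (cong (parity (f x) ℙ.+_) (parity-∑ f xs))

  unique-⊆⇒↭ : {xs ys : List X} → Unique xs → xs ⊆ ys → length ys ≤ length xs → xs ↭ ys
  unique-⊆⇒↭ {xs = []}     {[]}     _          _    _   = ↭.refl
  unique-⊆⇒↭ {xs = []}     {_ ∷ _}  _          _    ()
  unique-⊆⇒↭ {xs = x ∷ xs} {ys}     (x∉ ∷ !xs) xs⊆ys len
    with as , bs , refl ← ∈-∃++ (xs⊆ys (here refl)) =
    ↭.trans (↭.prep x (unique-⊆⇒↭ !xs xs⊆as++bs len′)) (↭-sym (shift x as bs))
    where
    xs⊆as++bs : xs ⊆ as ++ bs
    xs⊆as++bs y∈xs with ∈-++⁻ as (xs⊆ys (there y∈xs))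
    ... | inj₁ y∈as         = ∈-++⁺ˡ y∈as
    ... | inj₂ (here refl)  = ⊥-elim (All.lookup x∉ y∈xs refl)
    ... | inj₂ (there y∈bs) = ∈-++⁺ʳ as y∈bs
    len′ : length (as ++ bs) ≤ length xs
    len′ = ≤-pred (begin
      suc (length (as ++ bs))       ≡⟨ cong suc (length-++ as) ⟩
      suc (length as + length bs)   ≡⟨ +-suc (length as) (length bs) ⟨
      length as + suc (length bs)   ≡⟨ length-++ as ⟨
      length (as ++ x ∷ bs)         ≤⟨ len ⟩
      suc (length xs)               ∎)
      where open ≤-Reasoning

  InjectiveOn : ∀ {b} {B : Set b} → (X → B) → List X → Set _
  InjectiveOn f xs = ∀ {x y} → x ∈ xs → y ∈ xs → f x ≡ f y → x ≡ y

  map-unique : ∀ {b} {B : Set b} (f : X → B) {xs} → InjectiveOn f xs → Unique xs → Unique (map f xs)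
  map-unique f inj []         = []
  map-unique f inj (x∉ ∷ !xs) =
    All.map⁺ (All.tabulate (λ y∈xs → All.lookup x∉ y∈xs ∘ inj (here refl) (there y∈xs)))
    ∷ map-unique f (λ x∈ y∈ → inj (there x∈) (there y∈)) !xs

  injective-map-↭ : ∀ (f : X → X) {xs} → Unique xs → (∀ {x} → x ∈ xs → f x ∈ xs) →
                    InjectiveOn f xs → map f xs ↭ xs
  injective-map-↭ f {xs} !xs f∈ inj =
    unique-⊆⇒↭ (map-unique f inj !xs) fxs⊆xs (≤-reflexive (sym (length-map f xs)))
    where
    fxs⊆xs : map f xs ⊆ xs
    fxs⊆xs y∈ with _ , x∈ , refl ← ∈-map⁻ f y∈ = f∈ x∈

  range : ℕ → List ℕ
  range = applyDownFrom suc

  ∈-range⁺ : ∀ {h x} → 0 < x → x ≤ h → x ∈ range h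
  ∈-range⁺ {x = suc i} _ i<h = ∈-applyDownFrom⁺ suc i<h

  ∈-range⁻ : ∀ {h x} → x ∈ range h → 0 < x × x ≤ h
  ∈-range⁻ x∈ with _ , i<h , refl ← ∈-applyDownFrom⁻ suc x∈ = z<s , i<h

  range-unique : ∀ h → Unique (range h)
  range-unique h = Unique.applyDownFrom⁺₁ suc h (λ j<i _ → <⇒≢ j<i ∘ sym ∘ suc-injective)

  parity-odd : ∀ h → parity (suc (2 * h)) ≡ 1ℙ
  parity-odd h = trans (ℙₚ.+-homo-+ 1 (2 * h)) (cong (1ℙ ℙ.+_) (ℙₚ.*-homo-* 2 h))

  x+[x+y]≡y : ∀ x y → x ℙ.+ (x ℙ.+ y) ≡ y
  x+[x+y]≡y 0ℙ y  = refl
  x+[x+y]≡y 1ℙ 0ℙ = refl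
  x+[x+y]≡y 1ℙ 1ℙ = refl

  x≡y+z⇒z≡y+x : ∀ {x} y z → x ≡ y ℙ.+ z → z ≡ y ℙ.+ x
  x≡y+z⇒z≡y+x y z refl = sym (x+[x+y]≡y y z)

  ∑-const : ∀ c k → ℕ-Sum.∑ (λ _ → c) (range k) ≡ k * c
  ∑-const c zero    = refl
  ∑-const c (suc k) = cong (c +_) (∑-const c k)

  ∑-ones : ∀ k → ℙ-Sum.∑ (λ _ → 1ℙ) (range k) ≡ parity k
  ∑-ones zero    = refl
  ∑-ones (suc k) = trans (cong (1ℙ ℙ.+_) (∑-ones k)) (sym (ℙₚ.+-homo-+ 1 k))

  -- Congruences and units

  infix 4 _≡_mod_
  _≡_mod_ : ℕ → ℕ → (n : ℕ) → .{{NonZero n}} → Set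
  x ≡ y mod n = x % n ≡ y % n

  record Unit (n : ℕ) .{{_ : NonZero n}} (a : ℕ) : Set where
    constructor _,_
    field
      inverse     : ℕ
      inverse-law : a * inverse ≡ 1 mod n

  module _ {n : ℕ} .{{_ : NonZero n}} where

    +-cong-mod : ∀ {x x′ y y′} → x ≡ x′ mod n → y ≡ y′ mod n → x + y ≡ x′ + y′ mod n
    +-cong-mod {x} {x′} {y} {y′} x≡x′ y≡y′ = begin
      (x + y) % n               ≡⟨ %-distribˡ-+ x y n ⟩
      (x % n + y % n) % n       ≡⟨ cong₂ (λ u v → (u + v) % n) x≡x′ y≡y′ ⟩
      (x′ % n + y′ % n) % n     ≡⟨ %-distribˡ-+ x′ y′ n ⟨
      (x′ + y′) % n             ∎
      where open ≡-Reasoning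

    *-cong-mod : ∀ {x x′ y y′} → x ≡ x′ mod n → y ≡ y′ mod n → x * y ≡ x′ * y′ mod n
    *-cong-mod {x} {x′} {y} {y′} x≡x′ y≡y′ = begin
      (x * y) % n               ≡⟨ %-distribˡ-* x y n ⟩
      (x % n * (y % n)) % n     ≡⟨ cong₂ (λ u v → (u * v) % n) x≡x′ y≡y′ ⟩
      (x′ % n * (y′ % n)) % n   ≡⟨ %-distribˡ-* x′ y′ n ⟨
      (x′ * y′) % n             ∎
      where open ≡-Reasoning

    +-cancelʳ-mod : ∀ x y z → x + z ≡ y + z mod n → x ≡ y mod n
    +-cancelʳ-mod x y z eq = begin
      x % n                            ≡⟨ [m+kn]%n≡m%n x z n ⟨
      (x + z * n) % n                  ≡⟨ cong (_% n) (regroup x) ⟩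
      ((x + z) + z * pred n) % n       ≡⟨ +-cong-mod eq refl ⟩
      ((y + z) + z * pred n) % n       ≡⟨ cong (_% n) (regroup y) ⟨
      (y + z * n) % n                  ≡⟨ [m+kn]%n≡m%n y z n ⟩
      y % n                            ∎
      where
      open ≡-Reasoning
      regroup : ∀ w → w + z * n ≡ (w + z) + z * pred n
      regroup w = begin
        w + z * n                ≡⟨ cong (λ m → w + z * m) (suc-pred n) ⟨
        w + z * suc (pred n)     ≡⟨ cong (w +_) (*-suc z (pred n)) ⟩
        w + (z + z * pred n)     ≡⟨ +-assoc w z _ ⟨
        (w + z) + z * pred n     ∎

    unit-resp-mod : ∀ {a a′} → a ≡ a′ mod n → Unit n a → Unit n a′
    unit-resp-mod a≡a′ (c , ac≡1) = c , trans (*-cong-mod (sym a≡a′) refl) ac≡1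

    unit-* : ∀ {a b} → Unit n a → Unit n b → Unit n (a * b)
    unit-* {a} {b} (c , ac≡1) (d , bd≡1) =
      c * d , trans (cong (_% n) (*-interchange a b c d)) (*-cong-mod ac≡1 bd≡1)
      where
      open import Algebra.Properties.CommutativeSemigroup *-commutativeSemigroup
        using () renaming (interchange to *-interchange)

    unit-*⁻ˡ : ∀ {a b} → Unit n (a * b) → Unit n a
    unit-*⁻ˡ {a} {b} (c , abc≡1) = b * c , trans (cong (_% n) (sym (*-assoc a b c))) abc≡1

    unit-*⁻ʳ : ∀ {a b} → Unit n (a * b) → Unit n b
    unit-*⁻ʳ {a} {b} = unit-*⁻ˡ {b} {a} ∘ subst (Unit n) (*-comm a b)

    *-cancelˡ-mod : ∀ {a} → Unit n a → ∀ x y → a * x ≡ a * y mod n → x ≡ y mod n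
    *-cancelˡ-mod {a} (c , ac≡1) x y ax≡ay = begin
      x % n                ≡⟨ cong (_% n) (*-identityˡ x) ⟨
      (1 * x) % n          ≡⟨ *-cong-mod (sym ac≡1) refl ⟩
      ((a * c) * x) % n    ≡⟨ cong (_% n) (reassoc x) ⟩
      (c * (a * x)) % n    ≡⟨ *-cong-mod {c} refl ax≡ay ⟩
      (c * (a * y)) % n    ≡⟨ cong (_% n) (reassoc y) ⟨
      ((a * c) * y) % n    ≡⟨ *-cong-mod ac≡1 refl ⟩
      (1 * y) % n          ≡⟨ cong (_% n) (*-identityˡ y) ⟩
      y % n                ∎
      where
      open ≡-Reasoning
      reassoc : ∀ z → (a * c) * z ≡ c * (a * z)
      reassoc z = trans (cong (_* z) (*-comm a c)) (*-assoc c a z)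

    unit-*≡0 : ∀ {a} → Unit n a → ∀ x → a * x ≡ 0 mod n → x ≡ 0 mod n
    unit-*≡0 {a} u x ax≡0 = *-cancelˡ-mod {a} u x 0 (trans ax≡0 (cong (_% n) (sym (*-zeroʳ a))))

    complementary-residues : ∀ {u v} → u < n → v < n → 0 < v → u + v ≡ 0 mod n → u + v ≡ n
    complementary-residues {u} {v} u<n v<n 0<v u+v≡0 with u + v <? n
    ... | yes u+v<n = ⊥-elim (<⇒≢ (<-≤-trans 0<v (m≤n+m v u)) (sym (begin
      u + v           ≡⟨ m<n⇒m%n≡m u+v<n ⟨
      (u + v) % n     ≡⟨ u+v≡0 ⟩
      0 % n           ≡⟨ m<n⇒m%n≡m (>-nonZero⁻¹ n) ⟩
      0               ∎)))
      where open ≡-Reasoning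
    ... | no u+v≮n = begin
      u + v            ≡⟨ m∸n+n≡m n≤u+v ⟨
      w + n            ≡⟨ cong (_+ n) w≡0 ⟩
      n                ∎
      where
      open ≡-Reasoning
      n≤u+v = ≮⇒≥ u+v≮n
      w = u + v ∸ n
      w<n : w < n
      w<n = +-cancelʳ-< n w n (subst (_< n + n) (sym (m∸n+n≡m n≤u+v)) (+-mono-< u<n v<n))
      w≡0 : w ≡ 0
      w≡0 = begin
        w                ≡⟨ m<n⇒m%n≡m w<n ⟨
        w % n            ≡⟨ [m+n]%n≡m%n w n ⟨
        (w + n) % n      ≡⟨ cong (_% n) (m∸n+n≡m n≤u+v) ⟩
        (u + v) % n      ≡⟨ u+v≡0 ⟩
        0 % n            ≡⟨ m<n⇒m%n≡m (>-nonZero⁻¹ n) ⟩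
        0                ∎

  -- The Jacobi symbol in Gauss's form

  module HalfSystem (h : ℕ) where

    open ℙ-Sum

    n : ℕ
    n = suc (2 * h)

    upper : ℕ → Parity
    upper r with h <? r
    ... | yes _ = 1ℙ
    ... | no  _ = 0ℙ

    -- For 0 < r < n, fold r ∈ {1, …, h} is the absolute value of the absolutely least residue.
    fold : ℕ → ℕ
    fold r with h <? r
    ... | yes _ = n ∸ r
    ... | no  _ = r

    -- The Jacobi symbol (a | n), written additively: 1ℙ stands for −1.
    symbol : ℕ → Parity
    symbol a = ∑ (λ x → upper ((a * x) % n)) (range h)

    absRes : ℕ → ℕ → ℕ
    absRes a x = fold ((a * x) % n)

    floorSum : ℕ → ℕ
    floorSum a = ℕ-Sum.∑ (λ x → (a * x) / n) (range h)

    h+h<n : h + h < n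
    h+h<n = s≤s (≤-reflexive (cong (h +_) (sym (+-identityʳ h))))

    ∈half⇒<n : ∀ {x} → x ∈ range h → x < n
    ∈half⇒<n x∈ = ≤-<-trans (proj₂ (∈-range⁻ x∈)) (s≤s (m≤m+n h _))

    n∸r∈half : ∀ {r} → h < r → r < n → n ∸ r ∈ range h
    n∸r∈half {r} h<r r<n = ∈-range⁺ (m<n⇒0<n∸m r<n) (begin
      n ∸ r            ≤⟨ ∸-monoʳ-≤ n h<r ⟩
      n ∸ suc h        ≡⟨ trans (m+n∸m≡n h (1 * h)) (*-identityˡ h) ⟩
      h                ∎)
      where open ≤-Reasoning

    fold∈half : ∀ {r} → 0 < r → r < n → fold r ∈ range h
    fold∈half {r} 0<r r<n with h <? r
    ... | yes h<r = n∸r∈half h<r r<n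
    ... | no  h≮r = ∈-range⁺ 0<r (≮⇒≥ h≮r)

    fold≡⇒≡⊎complementary : ∀ {r s} → r ≤ n → s ≤ n → fold r ≡ fold s → r ≡ s ⊎ r + s ≡ n
    fold≡⇒≡⊎complementary {r} {s} r≤n s≤n eq with h <? r | h <? s
    ... | yes _ | yes _ = inj₁ (∸-cancelˡ-≡ r≤n s≤n eq)
    ... | yes _ | no  _ = inj₂ (trans (cong (r +_) (sym eq)) (m+[n∸m]≡n r≤n))
    ... | no  _ | yes _ = inj₂ (trans (cong (_+ s) eq) (m∸n+n≡m s≤n))
    ... | no  _ | no  _ = inj₁ eq

    upper-lower : ∀ {r} → r ≤ h → upper r ≡ 0ℙ
    upper-lower {r} r≤h with h <? r
    ... | yes h<r = ⊥-elim (<⇒≱ h<r r≤h)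
    ... | no  _   = refl

    upper-complement : ∀ {u v} → u + v ≡ n → upper u ≡ upper v ℙ.⁻¹
    upper-complement {u} {v} u+v≡n with h <? u | h <? v
    ... | yes h<u | yes h<v = ⊥-elim (<-irrefl (sym u+v≡n) (<-≤-trans n<2+h+h (+-mono-≤ h<u h<v)))
      where
      n<2+h+h : n < suc h + suc h
      n<2+h+h = ≤-reflexive (identity h)
        where
        identity : ∀ h → 2 + 2 * h ≡ (1 + h) + (1 + h)
        identity = solve-∀
    ... | yes _   | no  _   = refl
    ... | no  _   | yes _   = refl
    ... | no  h≮u | no  h≮v = ⊥-elim (<⇒≢ (≤-<-trans (+-mono-≤ (≮⇒≥ h≮u) (≮⇒≥ h≮v)) h+h<n) u+v≡n)

    %-half : ∀ {x} → x ∈ range h → x % n ≡ x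
    %-half = m<n⇒m%n≡m ∘ ∈half⇒<n

    module _ {a : ℕ} (unit : Unit n a) where

      residue-nonzero : ∀ {x} → x ∈ range h → 0 < (a * x) % n
      residue-nonzero {x} x∈ = n≢0⇒n>0 λ r≡0 →
        <⇒≢ (proj₁ (∈-range⁻ x∈)) (sym (trans (sym (%-half x∈)) (unit-*≡0 unit x r≡0)))

      absRes∈half : ∀ {x} → x ∈ range h → absRes a x ∈ range h
      absRes∈half {x} x∈ = fold∈half (residue-nonzero x∈) (m%n<n (a * x) n)

      absRes-injective : InjectiveOn (absRes a) (range h)
      absRes-injective {x} {y} x∈ y∈ eq
        with fold≡⇒≡⊎complementary (m%n≤n (a * x) n) (m%n≤n (a * y) n) eq
      ... | inj₁ ax≡ay = trans (sym (%-half x∈)) (trans (*-cancelˡ-mod unit x y ax≡ay) (%-half y∈))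
      ... | inj₂ sum≡n = ⊥-elim (<⇒≢ (+-mono-≤ (proj₁ (∈-range⁻ x∈)) z≤n) (sym x+y≡0))
        where
        open ≡-Reasoning
        a[x+y]≡0 : a * (x + y) ≡ 0 mod n
        a[x+y]≡0 = begin
          (a * (x + y)) % n                 ≡⟨ cong (_% n) (*-distribˡ-+ a x y) ⟩
          (a * x + a * y) % n               ≡⟨ %-distribˡ-+ (a * x) (a * y) n ⟩
          ((a * x) % n + (a * y) % n) % n   ≡⟨ cong (_% n) sum≡n ⟩
          n % n                             ≡⟨ n%n≡0 n ⟩
          0                                 ∎
        x+y≡0 : x + y ≡ 0
        x+y≡0 = begin
          x + y         ≡⟨ m<n⇒m%n≡m x+y<n ⟨
          (x + y) % n   ≡⟨ unit-*≡0 unit (x + y) a[x+y]≡0 ⟩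
          0             ∎
          where x+y<n = ≤-<-trans (+-mono-≤ (proj₂ (∈-range⁻ x∈)) (proj₂ (∈-range⁻ y∈))) h+h<n

      ∑-absRes : ∀ g → ∑ (g ∘ absRes a) (range h) ≡ ∑ g (range h)
      ∑-absRes g = trans (sym (∑-map g (absRes a) (range h)))
        (∑-↭ g (injective-map-↭ (absRes a) (range-unique h) absRes∈half absRes-injective))

    -- For r in the upper half, a·r and a·(n − r) are complementary residues,
    -- so exactly one of them lies in the upper half.
    upper-*-fold : ∀ {a r} → Unit n a → r < n →
                   upper ((a * r) % n) ≡ upper r ℙ.+ upper ((a * fold r) % n)
    upper-*-fold {a} {r} unit r<n with h <? r
    ... | no  _   = refl
    ... | yes h<r = upper-complement (complementary-residues (m%n<n (a * r) n) (m%n<n (a * (n ∸ r)) n)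
                                       (residue-nonzero unit (n∸r∈half h<r r<n)) sum≡0)
      where
      open ≡-Reasoning
      sum≡0 : (a * r) % n + (a * (n ∸ r)) % n ≡ 0 mod n
      sum≡0 = begin
        ((a * r) % n + (a * (n ∸ r)) % n) % n   ≡⟨ %-distribˡ-+ (a * r) (a * (n ∸ r)) n ⟨
        (a * r + a * (n ∸ r)) % n               ≡⟨ cong (_% n) (*-distribˡ-+ a r (n ∸ r)) ⟨
        (a * (r + (n ∸ r))) % n                 ≡⟨ cong (λ m → (a * m) % n) (m+[n∸m]≡n (<⇒≤ r<n)) ⟩
        (a * n) % n                             ≡⟨ m*n%n≡0 a n ⟩
        0                                       ∎

    upper-* : ∀ {a} → Unit n a → ∀ b x →
              upper ((a * b * x) % n) ≡ upper ((b * x) % n) ℙ.+ upper ((a * absRes b x) % n)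
    upper-* {a} ua b x =
      trans (cong upper ab·x≡a·bx) (upper-*-fold ua (m%n<n (b * x) n))
      where
      ab·x≡a·bx : a * b * x ≡ a * ((b * x) % n) mod n
      ab·x≡a·bx = trans (cong (_% n) (*-assoc a b x))
                        (*-cong-mod {x = a} {a} {b * x} {(b * x) % n} refl (sym (m%n%n≡m%n (b * x) n)))

    symbol-* : ∀ {a b} → Unit n a → Unit n b → symbol (a * b) ≡ symbol a ℙ.+ symbol b
    symbol-* {a} {b} ua ub = begin
      symbol (a * b)
        ≡⟨ ∑-cong (range h) (λ {x} _ → upper-* ua b x) ⟩
      ∑ (λ x → upper ((b * x) % n) ℙ.+ upper ((a * absRes b x) % n)) (range h)
        ≡⟨ ∑-distrib _ _ (range h) ⟩
      symbol b ℙ.+ ∑ (λ x → upper ((a * absRes b x) % n)) (range h)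
        ≡⟨ cong (symbol b ℙ.+_) (∑-absRes ub (λ y → upper ((a * y) % n))) ⟩
      symbol b ℙ.+ symbol a
        ≡⟨ ℙₚ.+-comm (symbol b) (symbol a) ⟩
      symbol a ℙ.+ symbol b
        ∎
      where open ≡-Reasoning

    symbol-resp-mod : ∀ {a a′} → a ≡ a′ mod n → symbol a ≡ symbol a′
    symbol-resp-mod {a} {a′} a≡a′ =
      ∑-cong (range h) (λ {x} _ → cong upper (*-cong-mod {x = a} {a′} {x} {x} a≡a′ refl))

    unit-one : Unit n 1
    unit-one = 1 , refl

    unit-two : Unit n 2
    unit-two = suc h , trans (cong (_% n) (identity h)) ([m+kn]%n≡m%n 1 1 n)
      where
      identity : ∀ h → 2 * suc h ≡ 1 + 1 * suc (2 * h)
      identity = solve-∀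

    unit-minus-one : Unit n (2 * h)
    unit-minus-one = 2 * h , +-cancelʳ-mod {n = n} (2 * h * (2 * h)) 1 (2 * h) (begin
      (2 * h * (2 * h) + 2 * h) % n   ≡⟨ cong (_% n) (+-comm _ (2 * h)) ⟩
      (2 * h + 2 * h * (2 * h)) % n   ≡⟨ cong (_% n) (*-suc (2 * h) (2 * h)) ⟨
      (2 * h * n) % n                 ≡⟨ m*n%n≡0 (2 * h) n ⟩
      0                               ≡⟨ n%n≡0 n ⟨
      n % n                           ∎)
      where open ≡-Reasoning

    unit-^ : ∀ {a} → Unit n a → ∀ s → Unit n (a ^ s)
    unit-^ unit zero    = unit-one
    unit-^ unit (suc s) = unit-* unit (unit-^ unit s)

    symbol-one : symbol 1 ≡ 0ℙ
    symbol-one = trans (symbol-* unit-one unit-one) (ℙₚ.p+p≡0ℙ (symbol 1))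

    symbol-^ : ∀ {a} → Unit n a → ∀ s → symbol (a ^ s) ≡ parity s ℙ.* symbol a
    symbol-^ unit zero = symbol-one
    symbol-^ {a} unit (suc s) = begin
      symbol (a * a ^ s)                    ≡⟨ symbol-* unit (unit-^ unit s) ⟩
      symbol a ℙ.+ symbol (a ^ s)           ≡⟨ cong (symbol a ℙ.+_) (symbol-^ unit s) ⟩
      symbol a ℙ.+ (parity s ℙ.* symbol a)  ≡⟨ ℙₚ.*-distribʳ-+ (symbol a) 1ℙ (parity s) ⟨
      (1ℙ ℙ.+ parity s) ℙ.* symbol a        ≡⟨ cong (ℙ._* symbol a) (ℙₚ.+-homo-+ 1 s) ⟨
      parity (suc s) ℙ.* symbol a           ∎
      where open ≡-Reasoning

    symbol-minus-one : symbol (2 * h) ≡ parity h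
    symbol-minus-one = trans (∑-cong (range h) upper-2h·x) (∑-ones h)
      where
      upper-2h·x : ∀ {x} → x ∈ range h → upper ((2 * h * x) % n) ≡ 1ℙ
      upper-2h·x {x} x∈ = trans (upper-complement sum≡n) (cong ℙ._⁻¹ (upper-lower (proj₂ (∈-range⁻ x∈))))
        where
        open ≡-Reasoning
        sum≡0 : (2 * h * x) % n + x ≡ 0 mod n
        sum≡0 = begin
          ((2 * h * x) % n + x) % n
            ≡⟨ +-cong-mod {n = n} {x = (2 * h * x) % n} {2 * h * x} {x} {x} (m%n%n≡m%n (2 * h * x) n) refl ⟩
          (2 * h * x + x) % n         ≡⟨ cong (_% n) (trans (+-comm (2 * h * x) x) (*-comm n x)) ⟩
          (x * n) % n                 ≡⟨ m*n%n≡0 x n ⟩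
          0                           ∎
        sum≡n : (2 * h * x) % n + x ≡ n
        sum≡n = complementary-residues (m%n<n (2 * h * x) n) (∈half⇒<n x∈) (proj₁ (∈-range⁻ x∈)) sum≡0

    parity-fold : ∀ {r} → r ≤ n → parity r ≡ parity (fold r) ℙ.+ upper r
    parity-fold {r} r≤n with h <? r
    ... | no  _ = sym (ℙₚ.+-identityʳ (parity r))
    ... | yes _ = x≡y+z⇒z≡y+x (parity (n ∸ r)) (parity r) (begin
      1ℙ                            ≡⟨ parity-odd h ⟨
      parity n                      ≡⟨ cong parity (m∸n+n≡m r≤n) ⟨
      parity (n ∸ r + r)            ≡⟨ ℙₚ.+-homo-+ (n ∸ r) r ⟩
      parity (n ∸ r) ℙ.+ parity r   ∎)
      where open ≡-Reasoning

    parity-quotient : ∀ a → parity a ≡ 1ℙ → ∀ x →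
                      parity ((a * x) / n) ≡ parity ((a * x) % n) ℙ.+ parity x
    parity-quotient a a-odd x = x≡y+z⇒z≡y+x (parity r) (parity q) (begin
      parity x                      ≡⟨ cong (ℙ._* parity x) a-odd ⟨
      parity a ℙ.* parity x         ≡⟨ ℙₚ.*-homo-* a x ⟨
      parity (a * x)                ≡⟨ cong parity (m≡m%n+[m/n]*n (a * x) n) ⟩
      parity (r + q * n)            ≡⟨ ℙₚ.+-homo-+ r (q * n) ⟩
      parity r ℙ.+ parity (q * n)   ≡⟨ cong (parity r ℙ.+_) (ℙₚ.*-homo-* q n) ⟩
      parity r ℙ.+ (parity q ℙ.* parity n) ≡⟨ cong (λ p → parity r ℙ.+ (parity q ℙ.* p)) (parity-odd h) ⟩
      parity r ℙ.+ (parity q ℙ.* 1ℙ) ≡⟨ cong (parity r ℙ.+_) (ℙₚ.*-identityʳ (parity q)) ⟩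
      parity r ℙ.+ parity q         ∎)
      where
      open ≡-Reasoning
      r = (a * x) % n
      q = (a * x) / n

    symbol≡parity-floorSum : ∀ {a} → Unit n a → parity a ≡ 1ℙ → symbol a ≡ parity (floorSum a)
    symbol≡parity-floorSum {a} unit a-odd = sym (begin
      parity (floorSum a)
        ≡⟨ parity-∑ _ (range h) ⟩
      ∑ (λ x → parity ((a * x) / n)) (range h)
        ≡⟨ ∑-cong (range h) pointwise ⟩
      ∑ (λ x → parity (absRes a x) ℙ.+ (parity x ℙ.+ upper ((a * x) % n))) (range h)
        ≡⟨ ∑-distrib (parity ∘ absRes a) (λ x → parity x ℙ.+ upper ((a * x) % n)) (range h) ⟩
      ∑ (parity ∘ absRes a) (range h) ℙ.+ ∑ (λ x → parity x ℙ.+ upper ((a * x) % n)) (range h)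
        ≡⟨ cong₂ ℙ._+_ (∑-absRes unit parity) (∑-distrib parity (λ x → upper ((a * x) % n)) (range h)) ⟩
      ∑ parity (range h) ℙ.+ (∑ parity (range h) ℙ.+ symbol a)
        ≡⟨ x+[x+y]≡y (∑ parity (range h)) (symbol a) ⟩
      symbol a
        ∎)
      where
      open ≡-Reasoning
      pointwise : ∀ {x} → x ∈ range h →
                  parity ((a * x) / n) ≡ parity (absRes a x) ℙ.+ (parity x ℙ.+ upper ((a * x) % n))
      pointwise {x} _ = begin
        parity ((a * x) / n)                          ≡⟨ parity-quotient a a-odd x ⟩
        parity r ℙ.+ parity x                         ≡⟨ cong (ℙ._+ parity x) (parity-fold (m%n≤n (a * x) n)) ⟩
        parity (fold r) ℙ.+ upper r ℙ.+ parity x      ≡⟨ ℙₚ.+-assoc (parity (fold r)) (upper r) (parity x) ⟩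
        parity (fold r) ℙ.+ (upper r ℙ.+ parity x)    ≡⟨ cong (parity (fold r) ℙ.+_) (ℙₚ.+-comm (upper r) _) ⟩
        parity (fold r) ℙ.+ (parity x ℙ.+ upper r)    ∎
        where r = (a * x) % n

    -- Passing to the odd representative 2 + n makes Eisenstein's formula applicable,
    -- and its quotients ⌊(2 + n)·x / n⌋ are just x.
    symbol-two : symbol 2 ≡ parity (ℕ-Sum.∑ (λ x → x) (range h))
    symbol-two = begin
      symbol 2                      ≡⟨ symbol-resp-mod {2} {2 + n} 2≡2+n ⟩
      symbol (2 + n)                ≡⟨ symbol≡parity-floorSum unit-2+n 2+n-odd ⟩
      parity (floorSum (2 + n))     ≡⟨ cong parity (ℕ-Sum.∑-cong (range h) quotient≡x) ⟩
      parity (ℕ-Sum.∑ (λ x → x) (range h)) ∎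
      where
      open ≡-Reasoning
      2≡2+n : 2 ≡ 2 + n mod n
      2≡2+n = sym ([m+n]%n≡m%n 2 n)
      unit-2+n : Unit n (2 + n)
      unit-2+n = unit-resp-mod {n = n} {2} {2 + n} 2≡2+n unit-two
      2+n-odd : parity (2 + n) ≡ 1ℙ
      2+n-odd = trans (ℙₚ.+-homo-+ 2 n) (parity-odd h)
      quotient≡x : ∀ {x} → x ∈ range h → ((2 + n) * x) / n ≡ x
      quotient≡x {x} x∈ = begin
        ((2 + n) * x) / n          ≡⟨ cong (_/ n) (identity n x) ⟩
        (2 * x + x * n) / n        ≡⟨ +-distrib-/-∣ʳ (2 * x) (divides-refl x) ⟩
        (2 * x) / n + (x * n) / n  ≡⟨ cong₂ _+_ (m<n⇒m/n≡0 2x<n) (m*n/n≡m x n) ⟩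
        x                          ∎
        where
        identity : ∀ n x → (2 + n) * x ≡ 2 * x + x * n
        identity = solve-∀
        2x<n : 2 * x < n
        2x<n = s≤s (*-monoʳ-≤ 2 (proj₂ (∈-range⁻ x∈)))

    x+y≡0⇒x≡2h*y : ∀ x y → x + y ≡ 0 mod n → x ≡ 2 * h * y mod n
    x+y≡0⇒x≡2h*y x y x+y≡0 = +-cancelʳ-mod {n = n} x (2 * h * y) y (begin
      (x + y) % n             ≡⟨ x+y≡0 ⟩
      0                       ≡⟨ m*n%n≡0 y n ⟨
      (y * n) % n             ≡⟨ cong (_% n) (trans (*-comm y n) (+-comm y (2 * h * y))) ⟩
      (2 * h * y + y) % n     ∎)
      where open ≡-Reasoning

    t+1≡0⇒t≡2h : ∀ t → t + 1 ≡ 0 mod n → t ≡ 2 * h mod n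
    t+1≡0⇒t≡2h t t+1≡0 = trans (x+y≡0⇒x≡2h*y t 1 t+1≡0) (cong (_% n) (*-identityʳ (2 * h)))

    symbol-negated-square : ∀ {b} k → Unit n b → k * k + b ≡ 0 mod n → symbol b ≡ parity h
    symbol-negated-square {b} k unit k²+b≡0 = trans (x≡y+z⇒z≡y+x (parity h) (symbol b) (begin
      0ℙ                        ≡⟨ ℙₚ.p+p≡0ℙ (symbol k) ⟨
      symbol k ℙ.+ symbol k     ≡⟨ symbol-* unit-k unit-k ⟨
      symbol (k * k)            ≡⟨ symbol-resp-mod {k * k} {2 * h * b} k²≡-b ⟩
      symbol (2 * h * b)        ≡⟨ symbol-* unit-minus-one unit ⟩
      symbol (2 * h) ℙ.+ symbol b ≡⟨ cong (ℙ._+ symbol b) symbol-minus-one ⟩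
      parity h ℙ.+ symbol b     ∎)) (ℙₚ.+-identityʳ (parity h))
      where
      open ≡-Reasoning
      k²≡-b : k * k ≡ 2 * h * b mod n
      k²≡-b = x+y≡0⇒x≡2h*y (k * k) b k²+b≡0
      unit-k : Unit n k
      unit-k = unit-*⁻ˡ (unit-resp-mod {n = n} {2 * h * b} {k * k} (sym k²≡-b)
                                                                  (unit-* unit-minus-one unit))

  -- Reciprocity

  χ : {P : Set ℓ} → Dec P → ℕ
  χ (yes _) = 1
  χ (no  _) = 0

  χ<+χ>≡1 : ∀ {u v} → u ≢ v → χ (u <? v) + χ (v <? u) ≡ 1
  χ<+χ>≡1 {u} {v} u≢v with u <? v | v <? u
  ... | yes u<v | yes v<u = ⊥-elim (<-asym u<v v<u)
  ... | yes _   | no  _   = refl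
  ... | no  _   | yes _   = refl
  ... | no  u≮v | no  v≮u = ⊥-elim (u≢v (≤-antisym (≮⇒≥ v≮u) (≮⇒≥ u≮v)))

  module _ (d N : ℕ) .{{_ : NonZero d}} (d∤N : N % d ≢ 0) where

    *<⇒≤/ : ∀ {y} → d * y < N → y ≤ N / d
    *<⇒≤/ {y} dy<N = subst (_≤ N / d) (m*n/n≡m y d) (/-monoˡ-≤ d (subst (_≤ N) (*-comm d y) (<⇒≤ dy<N)))

    ≤/⇒*< : ∀ {y} → y ≤ N / d → d * y < N
    ≤/⇒*< {y} y≤q = ≤∧≢⇒< (begin
      d * y         ≤⟨ *-monoʳ-≤ d y≤q ⟩
      d * (N / d)   ≡⟨ *-comm d (N / d) ⟩
      N / d * d     ≤⟨ m/n*n≤m N d ⟩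
      N             ∎) dy≢N
      where
      open ≤-Reasoning
      dy≢N : d * y ≢ N
      dy≢N dy≡N = d∤N (trans (cong (_% d) (trans (sym dy≡N) (*-comm d y))) (m*n%n≡0 y d))

    count-multiples-below : ∀ K → ℕ-Sum.∑ (λ y → χ (d * y <? N)) (range K) ≡ K ⊓ (N / d)
    count-multiples-below zero = refl
    count-multiples-below (suc K) with d * suc K <? N
    ... | yes below = begin
      suc (ℕ-Sum.∑ (λ y → χ (d * y <? N)) (range K))  ≡⟨ cong suc (count-multiples-below K) ⟩
      suc (K ⊓ (N / d))                                ≡⟨ cong suc (m≤n⇒m⊓n≡m (<⇒≤ 1+K≤q)) ⟩
      suc K                                            ≡⟨ m≤n⇒m⊓n≡m 1+K≤q ⟨
      suc K ⊓ (N / d)                                  ∎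
      where
      open ≡-Reasoning
      1+K≤q = *<⇒≤/ below
    ... | no ¬below = begin
      ℕ-Sum.∑ (λ y → χ (d * y <? N)) (range K)  ≡⟨ count-multiples-below K ⟩
      K ⊓ (N / d)                               ≡⟨ m≥n⇒m⊓n≡n q≤K ⟩
      N / d                                     ≡⟨ m≥n⇒m⊓n≡n (m≤n⇒m≤1+n q≤K) ⟨
      suc K ⊓ (N / d)                           ∎
      where
      open ≡-Reasoning
      q≤K : N / d ≤ K
      q≤K = ≤-pred (≰⇒> (¬below ∘ ≤/⇒*<))

  module LatticePoints (hb hm : ℕ) where

    b m : ℕ
    b = suc (2 * hb)
    m = suc (2 * hm)

    bx<[1+hb]m : ∀ {x} → x ≤ hm → b * x < suc hb * m
    bx<[1+hb]m {x} x≤hm = begin-strict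
      b * x                      ≤⟨ *-monoʳ-≤ b x≤hm ⟩
      b * hm                     <⟨ s≤s (m≤m+n (b * hm) (hb + hm)) ⟩
      suc (b * hm) + (hb + hm)   ≡⟨ identity hb hm ⟩
      suc hb * m                 ∎
      where
      open ≤-Reasoning
      identity : ∀ hb hm → suc (suc (2 * hb) * hm) + (hb + hm) ≡ suc hb * suc (2 * hm)
      identity = solve-∀

    floor-as-count : Unit m b → ∀ {x} → x ∈ range hm →
                     (b * x) / m ≡ ℕ-Sum.∑ (λ y → χ (m * y <? b * x)) (range hb)
    floor-as-count unit {x} x∈ = sym (begin
      ℕ-Sum.∑ (λ y → χ (m * y <? b * x)) (range hb)   ≡⟨ count-multiples-below m (b * x) m∤bx hb ⟩
      hb ⊓ ((b * x) / m)                              ≡⟨ m≥n⇒m⊓n≡n q≤hb ⟩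
      (b * x) / m                                     ∎)
      where
      open ≡-Reasoning
      m∤bx : (b * x) % m ≢ 0
      m∤bx = >⇒≢ (HalfSystem.residue-nonzero hm unit x∈)
      q≤hb : (b * x) / m ≤ hb
      q≤hb = ≤-pred (m<n*o⇒m/o<n (bx<[1+hb]m (proj₂ (∈-range⁻ x∈))))

  -- Both sums count lattice points (x, y) ∈ [1, hm] × [1, hb], on the two sides of
  -- the line m·y = b·x, which contains none of them.
  floorSum-reciprocity : ∀ hb hm → let b = suc (2 * hb); m = suc (2 * hm) in Unit m b → Unit b m →
                         HalfSystem.floorSum hm b + HalfSystem.floorSum hb m ≡ hm * hb
  floorSum-reciprocity hb hm ub um = begin
    ∑ (λ x → (b * x) / m) (range hm) + ∑ (λ y → (m * y) / b) (range hb)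
      ≡⟨ cong₂ _+_ (∑-cong (range hm) (LatticePoints.floor-as-count hb hm ub))
                   (∑-cong (range hb) (LatticePoints.floor-as-count hm hb um)) ⟩
    ∑ (λ x → ∑ (below x) (range hb)) (range hm) + ∑ (λ y → ∑ (λ x → above x y) (range hm)) (range hb)
      ≡⟨ cong (∑ (λ x → ∑ (below x) (range hb)) (range hm) +_)
              (∑-comm (λ y x → above x y) (range hb) (range hm)) ⟩
    ∑ (λ x → ∑ (below x) (range hb)) (range hm) + ∑ (λ x → ∑ (above x) (range hb)) (range hm)
      ≡⟨ ∑-distrib (λ x → ∑ (below x) (range hb)) (λ x → ∑ (above x) (range hb)) (range hm) ⟨
    ∑ (λ x → ∑ (below x) (range hb) + ∑ (above x) (range hb)) (range hm)
      ≡⟨ ∑-cong (range hm) row-count ⟩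
    ∑ (λ _ → hb) (range hm)
      ≡⟨ ∑-const hb hm ⟩
    hm * hb
      ∎
    where
    open ≡-Reasoning
    open ℕ-Sum
    b m : ℕ
    b = suc (2 * hb)
    m = suc (2 * hm)
    below above : ℕ → ℕ → ℕ
    below x y = χ (m * y <? b * x)
    above x y = χ (b * x <? m * y)
    row-count : ∀ {x} → x ∈ range hm → ∑ (below x) (range hb) + ∑ (above x) (range hb) ≡ hb
    row-count {x} x∈ = begin
      ∑ (below x) (range hb) + ∑ (above x) (range hb)   ≡⟨ ∑-distrib (below x) (above x) (range hb) ⟨
      ∑ (λ y → below x y + above x y) (range hb)        ≡⟨ ∑-cong (range hb) (λ _ → χ<+χ>≡1 my≢bx) ⟩
      ∑ (λ _ → 1) (range hb)                            ≡⟨ trans (∑-const 1 hb) (*-identityʳ hb) ⟩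
      hb                                                ∎
      where
      my≢bx : ∀ {y} → m * y ≢ b * x
      my≢bx {y} my≡bx = >⇒≢ (HalfSystem.residue-nonzero hm ub x∈)
        (trans (cong (_% m) (trans (sym my≡bx) (*-comm m y))) (m*n%n≡0 y m))

  quadratic-reciprocity : ∀ hb hm → let b = suc (2 * hb); m = suc (2 * hm) in Unit m b → Unit b m →
                          HalfSystem.symbol hm b ℙ.+ HalfSystem.symbol hb m ≡ parity (hm * hb)
  quadratic-reciprocity hb hm ub um = begin
    HalfSystem.symbol hm b ℙ.+ HalfSystem.symbol hb m
      ≡⟨ cong₂ ℙ._+_ (HalfSystem.symbol≡parity-floorSum hm ub (parity-odd hb))
                     (HalfSystem.symbol≡parity-floorSum hb um (parity-odd hm)) ⟩
    parity (HalfSystem.floorSum hm b) ℙ.+ parity (HalfSystem.floorSum hb m)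
      ≡⟨ ℙₚ.+-homo-+ (HalfSystem.floorSum hm b) (HalfSystem.floorSum hb m) ⟨
    parity (HalfSystem.floorSum hm b + HalfSystem.floorSum hb m)
      ≡⟨ cong parity (floorSum-reciprocity hb hm ub um) ⟩
    parity (hm * hb) ∎
    where
    open ≡-Reasoning
    b = suc (2 * hb)
    m = suc (2 * hm)

  *≡1ℙ⇒≡1ℙ : ∀ p q → p ℙ.* q ≡ 1ℙ → p ≡ 1ℙ × q ≡ 1ℙ
  *≡1ℙ⇒≡1ℙ 1ℙ 1ℙ _ = refl , refl

  odd-exponent-and-two-nonresidue : ∀ hb hm s {A C K} →
                                    let B = suc (2 * hb); m = suc (2 * hm); T = 2 ^ s * m in
                                    parity hb ≡ 1ℙ → B * C ≡ T + 1 → K * K + B ≡ A * T →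
                                    parity s ≡ 1ℙ × HalfSystem.symbol hb 2 ≡ 1ℙ
  odd-exponent-and-two-nonresidue hb hm s {A} {C} {K} hb-odd BC≡T+1 K²+B≡AT =
    *≡1ℙ⇒≡1ℙ (parity s) (B.symbol 2) (begin
    parity s ℙ.* B.symbol 2                      ≡⟨ ℙₚ.+-identityʳ _ ⟨
    parity s ℙ.* B.symbol 2 ℙ.+ 0ℙ               ≡⟨ cong (parity s ℙ.* B.symbol 2 ℙ.+_) symbol-B-m ⟨
    parity s ℙ.* B.symbol 2 ℙ.+ B.symbol m       ≡⟨ cong (ℙ._+ B.symbol m) (B.symbol-^ B.unit-two s) ⟨
    B.symbol (2 ^ s) ℙ.+ B.symbol m              ≡⟨ B.symbol-* (B.unit-^ B.unit-two s) unit-B-m ⟨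
    B.symbol T                                   ≡⟨ B.symbol-resp-mod {T} {2 * hb} T≡-1 ⟩
    B.symbol (2 * hb)                            ≡⟨ B.symbol-minus-one ⟩
    parity hb                                    ≡⟨ hb-odd ⟩
    1ℙ                                           ∎)
    where
    open ≡-Reasoning
    module B = HalfSystem hb
    module M = HalfSystem hm
    B m T : ℕ
    B = suc (2 * hb)
    m = suc (2 * hm)
    T = 2 ^ s * m
    unit-m-B : Unit m B
    unit-m-B = C , trans (cong (_% m) (trans BC≡T+1 (+-comm T 1))) ([m+kn]%n≡m%n 1 (2 ^ s) m)
    K²+B≡0 : K * K + B ≡ 0 mod m
    K²+B≡0 = trans (cong (_% m) (trans K²+B≡AT (sym (*-assoc A (2 ^ s) m)))) (m*n%n≡0 (A * 2 ^ s) m)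
    T+1≡0 : T + 1 ≡ 0 mod B
    T+1≡0 = trans (cong (_% B) (trans (sym BC≡T+1) (*-comm B C))) (m*n%n≡0 C B)
    T≡-1 : T ≡ 2 * hb mod B
    T≡-1 = B.t+1≡0⇒t≡2h T T+1≡0
    unit-B-m : Unit B m
    unit-B-m = unit-*⁻ʳ {a = 2 ^ s} (unit-resp-mod {n = B} {2 * hb} {T} (sym T≡-1) B.unit-minus-one)
    symbol-B-m : B.symbol m ≡ 0ℙ
    symbol-B-m = trans (x≡y+z⇒z≡y+x (parity hm) (B.symbol m) (begin
      parity hm                                  ≡⟨ ℙₚ.*-identityʳ (parity hm) ⟨
      parity hm ℙ.* 1ℙ                           ≡⟨ cong (parity hm ℙ.*_) hb-odd ⟨
      parity hm ℙ.* parity hb                    ≡⟨ ℙₚ.*-homo-* hm hb ⟨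
      parity (hm * hb)                           ≡⟨ quadratic-reciprocity hb hm unit-m-B unit-B-m ⟨
      M.symbol B ℙ.+ B.symbol m
        ≡⟨ cong (ℙ._+ B.symbol m) (M.symbol-negated-square K unit-m-B K²+B≡0) ⟩
      parity hm ℙ.+ B.symbol m                   ∎)) (ℙₚ.p+p≡0ℙ (parity hm))

  even-or-odd : ∀ N → ∃ λ k → N ≡ 2 * k ⊎ N ≡ suc (2 * k)
  even-or-odd zero = 0 , inj₁ refl
  even-or-odd (suc N) with even-or-odd N
  ... | k , inj₁ N≡2k  = k , inj₂ (cong suc N≡2k)
  ... | k , inj₂ N≡1+2k = suc k , inj₁ (trans (cong suc N≡1+2k) (sym (*-suc 2 k)))

  odd-part : ∀ N → 0 < N → ∃₂ λ s k → N ≡ 2 ^ s * suc (2 * k)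
  odd-part = <-rec _ split
    where
    split : ∀ N → (∀ {M} → M < N → 0 < M → ∃₂ λ s k → M ≡ 2 ^ s * suc (2 * k)) →
            0 < N → ∃₂ λ s k → N ≡ 2 ^ s * suc (2 * k)
    split N rec 0<N with even-or-odd N
    ... | k , inj₂ N≡1+2k = 0 , k , trans N≡1+2k (sym (+-identityʳ _))
    ... | k , inj₁ N≡2k =
      let s , j , k≡ = rec k<N 0<k in
      suc s , j , trans N≡2k (trans (cong (2 *_) k≡) (sym (*-assoc 2 (2 ^ s) _)))
      where
      0<k : 0 < k
      0<k = n≢0⇒n>0 (λ k≡0 → >⇒≢ 0<N (trans N≡2k (cong (2 *_) k≡0)))
      k<N : k < N
      k<N = subst (k <_) (sym N≡2k) (subst (k <_) (cong (k +_) (sym (+-identityʳ k))) (m<m+n k 0<k))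

  square≢5-mod-8 : ∀ K → (K * K) % 8 ≢ 5
  square≢5-mod-8 K = subst (_≢ 5) (sym (%-distribˡ-* K K 8)) (residue (K % 8) (m%n<n K 8))
    where
    residue : ∀ r → r < 8 → (r * r) % 8 ≢ 5
    residue 0 _ ()
    residue 1 _ ()
    residue 2 _ ()
    residue 3 _ ()
    residue 4 _ ()
    residue 5 _ ()
    residue 6 _ ()
    residue 7 _ ()
    residue (suc (suc (suc (suc (suc (suc (suc (suc _))))))))
            (s≤s (s≤s (s≤s (s≤s (s≤s (s≤s (s≤s (s≤s ()))))))))

  triangular : ∀ k → 2 * ℕ-Sum.∑ (λ x → x) (range k) ≡ k * suc k
  triangular zero    = refl
  triangular (suc k) = begin
    2 * (suc k + S)        ≡⟨ *-distribˡ-+ 2 (suc k) S ⟩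
    2 * suc k + 2 * S      ≡⟨ cong (2 * suc k +_) (triangular k) ⟩
    2 * suc k + k * suc k  ≡⟨ *-distribʳ-+ (suc k) 2 k ⟨
    suc (suc k) * suc k    ≡⟨ *-comm (suc (suc k)) (suc k) ⟩
    suc k * suc (suc k)    ∎
    where
    open ≡-Reasoning
    S = ℕ-Sum.∑ (λ x → x) (range k)

  ∑-range-even : ∀ u → parity (ℕ-Sum.∑ (λ x → x) (range (suc (2 * suc (2 * u))))) ≡ 0ℙ
  ∑-range-even u = begin
    parity (ℕ-Sum.∑ (λ x → x) (range k))      ≡⟨ cong parity ∑≡k[2+2u] ⟩
    parity (k * (2 * suc u))                  ≡⟨ ℙₚ.*-homo-* k (2 * suc u) ⟩
    parity k ℙ.* parity (2 * suc u)           ≡⟨ cong (parity k ℙ.*_) (ℙₚ.*-homo-* 2 (suc u)) ⟩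
    parity k ℙ.* 0ℙ                           ≡⟨ ℙₚ.*-zeroʳ (parity k) ⟩
    0ℙ                                        ∎
    where
    open ≡-Reasoning
    k = suc (2 * suc (2 * u))
    ∑≡k[2+2u] : ℕ-Sum.∑ (λ x → x) (range k) ≡ k * (2 * suc u)
    ∑≡k[2+2u] = *-cancelˡ-≡ _ (k * (2 * suc u)) 2 (trans (triangular k) (identity u))
      where
      identity : ∀ u → let k = suc (2 * suc (2 * u)) in k * suc k ≡ 2 * (k * (2 * suc u))
      identity = solve-∀

  square+4β+3≡0-mod-8⇒β-odd : ∀ K β → K * K + (4 * β + 3) ≡ 0 mod 8 → ∃ λ u → β ≡ suc (2 * u)
  square+4β+3≡0-mod-8⇒β-odd K β K²+B≡0 with even-or-odd β
  ... | u , inj₂ β≡1+2u = u , β≡1+2u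
  ... | u , inj₁ refl   = ⊥-elim (square≢5-mod-8 K (+-cancelʳ-mod (K * K) 5 (4 * (2 * u) + 3) (begin
    (K * K + (4 * (2 * u) + 3)) % 8    ≡⟨ K²+B≡0 ⟩
    0                                   ≡⟨ m*n%n≡0 (suc u) 8 ⟨
    (suc u * 8) % 8                     ≡⟨ cong (_% 8) (identity u) ⟩
    (5 + (4 * (2 * u) + 3)) % 8         ∎)))
    where
    open ≡-Reasoning
    identity : ∀ u → suc u * 8 ≡ 5 + (4 * (2 * u) + 3)
    identity = solve-∀

  square+4β+3≡0-mod-8⇒symbol-two≡0ℙ : ∀ K β → K * K + (4 * β + 3) ≡ 0 mod 8 →
                                      HalfSystem.symbol (suc (2 * β)) 2 ≡ 0ℙ
  square+4β+3≡0-mod-8⇒symbol-two≡0ℙ K β K²+B≡0 with u , refl ← square+4β+3≡0-mod-8⇒β-odd K β K²+B≡0 =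
    trans (HalfSystem.symbol-two (suc (2 * suc (2 * u)))) (∑-range-even u)

  2^[2+s]*m≡0-mod-8 : ∀ s m → parity (2 + s) ≡ 1ℙ → 2 ^ (2 + s) * m ≡ 0 mod 8
  2^[2+s]*m≡0-mod-8 (suc s) m _ = trans (cong (_% 8) (identity (2 ^ s) m)) (m*n%n≡0 (2 ^ s * m) 8)
    where
    identity : ∀ p m → 2 * (2 * (2 * p)) * m ≡ p * m * 8
    identity = solve-∀

  K²+B≡A[BC∸1] : ∀ A B C K T → A * B * C ≡ K * K + A + B → B * C ≡ T + 1 → K * K + B ≡ A * T
  K²+B≡A[BC∸1] A B C K T ABC≡K²+A+B BC≡T+1 = +-cancelʳ-≡ A (K * K + B) (A * T) (begin
    K * K + B + A        ≡⟨ +-assoc (K * K) B A ⟩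
    K * K + (B + A)      ≡⟨ cong (K * K +_) (+-comm B A) ⟩
    K * K + (A + B)      ≡⟨ +-assoc (K * K) A B ⟨
    K * K + A + B        ≡⟨ ABC≡K²+A+B ⟨
    A * B * C            ≡⟨ *-assoc A B C ⟩
    A * (B * C)          ≡⟨ cong (A *_) BC≡T+1 ⟩
    A * (T + 1)          ≡⟨ *-distribˡ-+ A T 1 ⟩
    A * T + A * 1        ≡⟨ cong (A * T +_) (*-identityʳ A) ⟩
    A * T + A            ∎)
    where open ≡-Reasoning

  no-square : ∀ α β γ K → (α + 1) * (4 * β + 3) * (4 * γ + 3) ≢ K * K + (α + 1) + (4 * β + 3)
  no-square α β γ K ABC≡K²+A+B with odd-part (2 + (3 * β + 3 * γ + 4 * β * γ)) z<s
  ... | s , hm , N≡2^s·m = ℙₚ.p≢p⁻¹ 1ℙ (trans (sym (proj₂ obstruction)) two-residue)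
    where
    open ≡-Reasoning
    A B C m T : ℕ
    A = α + 1
    B = 4 * β + 3
    C = 4 * γ + 3
    m = suc (2 * hm)
    T = 2 ^ (2 + s) * m

    BC≡T+1 : B * C ≡ T + 1
    BC≡T+1 = begin
      B * C                                          ≡⟨ identity β γ ⟩
      4 * (2 + (3 * β + 3 * γ + 4 * β * γ)) + 1      ≡⟨ cong (λ N → 4 * N + 1) N≡2^s·m ⟩
      4 * (2 ^ s * m) + 1                            ≡⟨ cong (_+ 1) (regroup (2 ^ s) m) ⟩
      T + 1                                          ∎
      where
      identity : ∀ β γ → (4 * β + 3) * (4 * γ + 3) ≡ 4 * (2 + (3 * β + 3 * γ + 4 * β * γ)) + 1
      identity = solve-∀
      regroup : ∀ p m → 4 * (p * m) ≡ 2 * (2 * p) * m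
      regroup = solve-∀

    K²+B≡AT : K * K + B ≡ A * T
    K²+B≡AT = K²+B≡A[BC∸1] A B C K T ABC≡K²+A+B BC≡T+1

    B≡1+2hb : B ≡ suc (2 * suc (2 * β))
    B≡1+2hb = identity β
      where
      identity : ∀ β → 4 * β + 3 ≡ suc (2 * suc (2 * β))
      identity = solve-∀

    obstruction : parity (2 + s) ≡ 1ℙ × HalfSystem.symbol (suc (2 * β)) 2 ≡ 1ℙ
    obstruction = odd-exponent-and-two-nonresidue (suc (2 * β)) hm (2 + s) {A} {C} {K} (parity-odd β)
      (subst (λ b → b * C ≡ T + 1) B≡1+2hb BC≡T+1) (subst (λ b → K * K + b ≡ A * T) B≡1+2hb K²+B≡AT)

    two-residue : HalfSystem.symbol (suc (2 * β)) 2 ≡ 0ℙ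
    two-residue = square+4β+3≡0-mod-8⇒symbol-two≡0ℙ K β (trans (cong (_% 8) K²+B≡AT)
      (trans (*-cong-mod {x = A} {A} {T} {0} refl (2^[2+s]*m≡0-mod-8 s m (proj₁ obstruction)))
             (cong (_% 8) (*-zeroʳ A))))

open import Defs using (p)
open import Data.Nat.Base as ℕ using (ℕ)
open import Data.Integer.Base using (ℤ; +_; -[1+_]; _+_; _-_; _*_; ∣_∣)
open import Data.Integer.Properties using (pos-+; pos-*; +-injective)
open import Data.Integer.Tactic.RingSolver using (solve-∀)

square≡∣∣² : ∀ k → k * k ≡ + (∣ k ∣ ℕ.* ∣ k ∣)
square≡∣∣² (+ n)    = sym (pos-* n n)
square≡∣∣² -[1+ n ] = refl

pos-4x+3 : ∀ x → + 4 * + x + + 3 ≡ + (4 ℕ.* x ℕ.+ 3)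
pos-4x+3 x = trans (cong (_+ + 3) (sym (pos-* 4 x))) (sym (pos-+ (4 ℕ.* x) 3))

p-cast : ∀ α β γ → let a = α ℕ.+ 1; b = 4 ℕ.* β ℕ.+ 3; c = 4 ℕ.* γ ℕ.+ 3 in
         p (+ α) (+ β) (+ γ) ≡ + a * + b * + c - + a - + b
p-cast α β γ = trans (cong₂ (λ x y → x * y * (+ 4 * + γ + + 3) - x - y) (sym (pos-+ α 1)) (pos-4x+3 β))
                     (cong (λ z → + a * + b * z - + a - + b) (pos-4x+3 γ))
  where
  a b : ℕ
  a = α ℕ.+ 1
  b = 4 ℕ.* β ℕ.+ 3

lemma4p2 : (α β γ : ℕ) → (k : ℤ) → ¬ (p (+ α) (+ β) (+ γ) ≡ k * k)
lemma4p2 α β γ k p≡k² = no-square α β γ ∣ k ∣ (+-injective (begin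
  + (a ℕ.* b ℕ.* c)                        ≡⟨ trans (pos-* (a ℕ.* b) c) (cong (_* + c) (pos-* a b)) ⟩
  + a * + b * + c                          ≡⟨ x≡[x-y-z]+y+z (+ a * + b * + c) (+ a) (+ b) ⟩
  + a * + b * + c - + a - + b + + a + + b  ≡⟨ cong (λ x → x + + a + + b) (trans (sym (p-cast α β γ)) p≡k²) ⟩
  k * k + + a + + b                        ≡⟨ cong (λ x → x + + a + + b) (square≡∣∣² k) ⟩
  + K² + + a + + b                         ≡⟨ trans (pos-+ (K² ℕ.+ a) b) (cong (_+ + b) (pos-+ K² a)) ⟨
  + (K² ℕ.+ a ℕ.+ b)                       ∎))
  where
  open ≡-Reasoning
  a b c K² : ℕ
  a  = α ℕ.+ 1
  b  = 4 ℕ.* β ℕ.+ 3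
  c  = 4 ℕ.* γ ℕ.+ 3
  K² = ∣ k ∣ ℕ.* ∣ k ∣
  x≡[x-y-z]+y+z : ∀ x y z → x ≡ x - y - z + y + z
  x≡[x-y-z]+y+z = solve-∀
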